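{- Let $\mathbf{Acyc}_{\mathbf{LF}}\subseteq\mathbf{LF}$ and $\mathbf{Acyc}_{\mathbf{AF}}\subseteq\mathbf{AF}$ be the sets of acyclic quivers. Then $\mathbf{Acyc}_{\mathbf{LF}}$ is not dense, has empty interior, and is closed in $\mathbf{LF}$; and $\mathbf{Acyc}_{\mathbf{AF}}$ is not dense, has empty interior, and is closed in $\mathbf{AF}$.
   Context: $\mathbb{N}$ is the positive integers. A quiver on $\mathbb{N}$ is a function $Q:\mathbb{N}\times\mathbb{N}\to\mathbb{Z}$ with $Q(x,y)=-Q(y,x)$; it is locally finite if $\sum_y|Q(x,y)|<\infty$ for each $x$. $\mathbf{AF}$ is the set of all quivers on $\mathbb{N}$ with the topology generated by $U_{Q,V}=\{Q':Q'(x,y)=Q(x,y)\ \forall x,y\in V\}$, $V$ finite. $\mathbf{LF}$ is the set of locally finite quivers with the topology generated by $\{Q'\in\mathbf{LF}:Q'(x,y)=Q(x,y)\text{ whenever }x\in V\text{ or }y\in V\}$, $V$ finite. A quiver is acyclic if there is no finite sequence of vertices $v_1,\dots,v_\ell$ with $Q(v_i,v_{i+1})>0$ for all $i$ (indices mod $\ell$). -}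

module Defs where

open import Level using (0ℓ)
open import Data.Nat using (ℕ; zero; suc; _≤_; _<_)
import Data.Nat as ℕ
open import Data.Integer using (ℤ; +_; -_; ∣_∣)
import Data.Integer as ℤ
open import Data.List using (List)
open import Data.List.Membership.Propositional using (_∈_)
open import Data.Product using (Σ; ∃; ∃-syntax; _×_; _,_)
open import Data.Sum using (_⊎_)
open import Relation.Nullary using (¬_)
open import Relation.Binary.PropositionalEquality using (_≡_)

-- Vertices: the positive integers 1,2,3,... are represented by Agda's ℕ
-- (vertex n in Agda stands for n+1); this is a harmless relabelling.

record Quiver : Set where
  field
    arr     : ℕ → ℕ → ℤ
    antisym : ∀ x y → arr x y ≡ - arr y x
open Quiver public

rowSum : Quiver → ℕ → ℕ → ℕ
rowSum Q x zero    = 0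
rowSum Q x (suc n) = rowSum Q x n ℕ.+ ∣ arr Q x n ∣

-- Locally finite: for every x the series Σ_y |Q(x,y)| (of nonnegative terms)
-- converges, i.e. its partial sums are bounded.
LocallyFinite : Quiver → Set
LocallyFinite Q = ∀ x → ∃[ B ] (∀ n → rowSum Q x n ≤ B)

LFQuiver : Set
LFQuiver = Σ Quiver LocallyFinite

-- An oriented cycle: ℓ ≥ 1 vertices v 0, …, v (ℓ-1) with Q(v i, v (i+1)) > 0
-- for all i < ℓ, indices mod ℓ (encoded by v ℓ ≡ v 0).
HasCycle : Quiver → Set
HasCycle Q = Σ ℕ λ ℓ → Σ (ℕ → ℕ) λ v →
               1 ≤ ℓ × v ℓ ≡ v 0 ×
               (∀ i → i < ℓ → + 0 ℤ.< arr Q (v i) (v (suc i)))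

Acyclic : Quiver → Set
Acyclic Q = ¬ HasCycle Q

-- Topology generated by basic neighbourhoods: Nbhd q V q' means q' lies in
-- the basic open set determined by q and the finite vertex set V.
module Topology {X : Set} (Nbhd : X → List ℕ → X → Set) where

  IsOpen : (X → Set) → Set
  IsOpen U = ∀ q → U q → Σ (List ℕ) λ V → ∀ q' → Nbhd q V q' → U q'

  IsClosed : (X → Set) → Set
  IsClosed A = IsOpen (λ q → ¬ A q)

  Dense : (X → Set) → Set₁
  Dense A = ∀ (U : X → Set) → IsOpen U → (Σ X U) → Σ X λ q → U q × A q

  EmptyInterior : (X → Set) → Set₁
  EmptyInterior A = ∀ (U : X → Set) → IsOpen U → (∀ q → U q → A q) → ∀ q → ¬ U q

NbhdAF : Quiver → List ℕ → Quiver → Set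
NbhdAF Q V Q' = ∀ x y → x ∈ V → y ∈ V → arr Q' x y ≡ arr Q x y

NbhdLF : LFQuiver → List ℕ → LFQuiver → Set
NbhdLF (Q , _) V (Q' , _) = ∀ x y → (x ∈ V ⊎ y ∈ V) → arr Q' x y ≡ arr Q x y

module AF = Topology NbhdAF
module LF = Topology NbhdLF

AcycAF : Quiver → Set
AcycAF = Acyclic

AcycLF : LFQuiver → Set
AcycLF (Q , _) = Acyclic Q

{-# OPTIONS --safe #-}
-- An oriented cycle is witnessed by finitely many arrows, so the cyclic quivers form an open
-- set in both topologies, and its complement Acyc is closed (classically: to find the
-- neighbourhood one needs the cycle itself, not just the failure of acyclicity).  Conversely,
-- grafting an oriented triangle onto three vertices beyond a finite set V changes no arrow
-- incident to V and only finitely many entries of each row, so every basic neighbourhood in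
-- either topology contains a cyclic quiver: Acyc has empty interior, and it is not dense
-- because it misses the nonempty open set of cyclic quivers.
module Submission where

open import Defs
open import Level using (0ℓ)
open import Axiom.ExcludedMiddle using (ExcludedMiddle)
open import Axiom.DoubleNegationElimination using (DoubleNegationElimination; em⇒dne)
open import Data.Bool using (true; false; _∧_; if_then_else_)
open import Data.Bool.Properties using (∧-zeroʳ)
open import Data.Integer using (∣_∣; _⊖_; 0ℤ; +<+)
import Data.Integer as ℤ
open import Data.Integer.Properties using (⊖-swap)
open import Data.List using (List; applyUpTo)
open import Data.List.Extrema.Nat using (max; xs≤max)
open import Data.List.Membership.Propositional using (_∈_; _∉_)
open import Data.List.Membership.Propositional.Properties using (∈-applyUpTo⁺; ∈-applyUpTo⁻)
import Data.List.Relation.Unary.All as All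
open import Data.Nat using (ℕ; zero; suc; _+_; _∸_; _≤_; _<_; _≤′_; ≤′-refl; ≤′-step; _≤?_; z≤n; s≤s)
import Data.Nat as ℕ
open import Data.List.Membership.DecPropositional ℕ._≟_ using (_∈?_)
open import Data.Nat.DivMod using (_%_; m%n<n)
open import Data.Nat.Properties
open import Data.Product using (Σ; _×_; _,_; proj₁; proj₂)
import Data.Sum as Sum
open import Data.Sum using (_⊎_; inj₁; inj₂)
open import Function using (_∘_)
open import Relation.Nullary using (¬_; yes; no; does)
open import Relation.Nullary.Decidable using (dec-true; dec-false)
open import Relation.Unary using (∁)
open import Relation.Binary.PropositionalEquality

module TopologyProperties {X : Set} (Nbhd : X → List ℕ → X → Set) where
  open Topology Nbhd

  MeetsEveryNbhd : (X → Set) → Set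
  MeetsEveryNbhd P = ∀ q V → Σ X λ q' → Nbhd q V q' × P q'

  open∧nonempty⇒∁-¬Dense : ∀ {P} → IsOpen P → Σ X P → ¬ Dense (∁ P)
  open∧nonempty⇒∁-¬Dense P-open inhabited dense =
    let _ , Pq , ¬Pq = dense _ P-open inhabited in ¬Pq Pq

  meetsEveryNbhd⇒∁-EmptyInterior : ∀ {P} → MeetsEveryNbhd P → EmptyInterior (∁ P)
  meetsEveryNbhd⇒∁-EmptyInterior meets U U-open U⊆∁P q Uq =
    let V , nbhd⊆U      = U-open q Uq
        q' , q'∈nbhd , Pq' = meets q V
    in U⊆∁P q' (nbhd⊆U q' q'∈nbhd) Pq'

  open⇒∁-closed : ∀ {P} → DoubleNegationElimination 0ℓ → IsOpen P → IsClosed (∁ P)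
  open⇒∁-closed dne P-open q ¬¬Pq =
    let V , nbhd⊆P = P-open q (dne ¬¬Pq)
    in V , λ q' q'∈nbhd ¬Pq' → ¬Pq' (nbhd⊆P q' q'∈nbhd)

module AFTopology = TopologyProperties NbhdAF
module LFTopology = TopologyProperties NbhdLF

rowSum-mono : ∀ Q x {m n} → m ≤ n → rowSum Q x m ≤ rowSum Q x n
rowSum-mono Q x = mono′ ∘ ≤⇒≤′
  where
  mono′ : ∀ {m n} → m ≤′ n → rowSum Q x m ≤ rowSum Q x n
  mono′ ≤′-refl       = ≤-refl
  mono′ (≤′-step m≤n) = ≤-trans (mono′ m≤n) (m≤m+n _ _)

rowSum-≤-eventuallyEqual : ∀ {Q Q' x M} → (∀ y → M ≤ y → arr Q' x y ≡ arr Q x y) →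
                           ∀ n → rowSum Q' x n ≤ rowSum Q' x M + rowSum Q x n
rowSum-≤-eventuallyEqual                  _  zero    = z≤n
rowSum-≤-eventuallyEqual {Q} {Q'} {x} {M} eq (suc n) with M ≤? n
... | no  M≰n = ≤-trans (rowSum-mono Q' x (≰⇒> M≰n)) (m≤m+n _ _)
... | yes M≤n = begin
  rowSum Q' x n + ∣ arr Q' x n ∣                 ≡⟨ cong (λ a → rowSum Q' x n + ∣ a ∣) (eq n M≤n) ⟩
  rowSum Q' x n + ∣ arr Q x n ∣                  ≤⟨ +-monoˡ-≤ _ (rowSum-≤-eventuallyEqual eq n) ⟩
  rowSum Q' x M + rowSum Q x n + ∣ arr Q x n ∣   ≡⟨ +-assoc (rowSum Q' x M) _ _ ⟩
  rowSum Q' x M + (rowSum Q x n + ∣ arr Q x n ∣) ∎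
  where open ≤-Reasoning

locallyFinite-eventuallyEqual : ∀ {Q Q'} M → (∀ x y → M ≤ y → arr Q' x y ≡ arr Q x y) →
                                LocallyFinite Q → LocallyFinite Q'
locallyFinite-eventuallyEqual {Q' = Q'} M eq finite x =
  let B , bounded = finite x
  in rowSum Q' x M + B ,
     λ n → ≤-trans (rowSum-≤-eventuallyEqual (eq x) n) (+-monoʳ-≤ _ (bounded n))

emptyQuiver : Quiver
emptyQuiver = record { arr = λ _ _ → 0ℤ ; antisym = λ _ _ → refl }

emptyQuiver-locallyFinite : LocallyFinite emptyQuiver
emptyQuiver-locallyFinite x = 0 , ≤-reflexive ∘ rowSum≡0
  where
  rowSum≡0 : ∀ n → rowSum emptyQuiver x n ≡ 0
  rowSum≡0 zero    = refl
  rowSum≡0 (suc n) = trans (+-identityʳ _) (rowSum≡0 n)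

cycleVertices : ∀ Q → HasCycle Q → List ℕ
cycleVertices _ (ℓ , v , _) = applyUpTo v (suc ℓ)

hasCycle-transport : ∀ Q Q' (c : HasCycle Q) → NbhdAF Q (cycleVertices Q c) Q' → HasCycle Q'
hasCycle-transport _ _ (ℓ , v , 1≤ℓ , closed , positive) agree =
  ℓ , v , 1≤ℓ , closed , λ i i<ℓ →
    subst (0ℤ ℤ.<_)
          (sym (agree (v i) (v (suc i)) (∈-applyUpTo⁺ v (m<n⇒m<1+n i<ℓ)) (∈-applyUpTo⁺ v (s≤s i<ℓ))))
          (positive i i<ℓ)

NbhdLF⇒NbhdAF : ∀ {V} q q' → NbhdLF q V q' → NbhdAF (proj₁ q) V (proj₁ q')
NbhdLF⇒NbhdAF _ _ agree x y x∈V _ = agree x y (inj₁ x∈V)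

hasCycle-openAF : AF.IsOpen HasCycle
hasCycle-openAF Q c = cycleVertices Q c , λ Q' → hasCycle-transport Q Q' c

hasCycle-openLF : LF.IsOpen (HasCycle ∘ proj₁)
hasCycle-openLF q c =
  cycleVertices (proj₁ q) c , λ q' → hasCycle-transport (proj₁ q) (proj₁ q') c ∘ NbhdLF⇒NbhdAF q q'

netArrows : (ℕ → ℕ → ℕ) → Quiver
netArrows a = record { arr = λ x y → a x y ⊖ a y x ; antisym = λ x y → ⊖-swap (a x y) (a y x) }

triangle : Quiver
triangle = netArrows arrows
  where
  arrows : ℕ → ℕ → ℕ
  arrows 0 1 = 1
  arrows 1 2 = 1
  arrows 2 0 = 1
  arrows _ _ = 0

triangle-hasCycle : HasCycle triangle
triangle-hasCycle = 3 , (_% 3) , s≤s z≤n , refl , positive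
  where
  positive : ∀ i → i < 3 → 0ℤ ℤ.< arr triangle (i % 3) (suc i % 3)
  positive 0 _ = +<+ (s≤s z≤n)
  positive 1 _ = +<+ (s≤s z≤n)
  positive 2 _ = +<+ (s≤s z≤n)
  positive (suc (suc (suc _))) (s≤s (s≤s (s≤s ())))

relabel : (ℕ → ℕ) → Quiver → Quiver
relabel f Q = record { arr = λ x y → arr Q (f x) (f y) ; antisym = λ x y → antisym Q (f x) (f y) }

relabel-hasCycle : ∀ f g Q → (∀ a → f (g a) ≡ a) → HasCycle Q → HasCycle (relabel f Q)
relabel-hasCycle _ g Q fg≗id (ℓ , v , 1≤ℓ , closed , positive) =
  ℓ , g ∘ v , 1≤ℓ , cong g closed , λ i i<ℓ →
    subst (0ℤ ℤ.<_) (sym (cong₂ (arr Q) (fg≗id (v i)) (fg≗id (v (suc i))))) (positive i i<ℓ)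

overwrite : List ℕ → Quiver → Quiver → Quiver
arr (overwrite W C Q) x y = if does (x ∈? W) ∧ does (y ∈? W) then arr C x y else arr Q x y
antisym (overwrite W C Q) x y with does (x ∈? W) | does (y ∈? W)
... | true  | true  = antisym C x y
... | true  | false = antisym Q x y
... | false | true  = antisym Q x y
... | false | false = antisym Q x y

module _ (W : List ℕ) (C Q : Quiver) where

  overwrite-inside : NbhdAF C W (overwrite W C Q)
  overwrite-inside x y x∈W y∈W rewrite dec-true (x ∈? W) x∈W | dec-true (y ∈? W) y∈W = refl

  overwrite-outside : ∀ {x y} → x ∉ W ⊎ y ∉ W → arr (overwrite W C Q) x y ≡ arr Q x y
  overwrite-outside {x} (inj₁ x∉W) rewrite dec-false (x ∈? W) x∉W = refl
  overwrite-outside {x} {y} (inj₂ y∉W)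
    rewrite dec-false (y ∈? W) y∉W | ∧-zeroʳ (does (x ∈? W)) = refl

module _ (N : ℕ) where

  private
    triangleAt : Quiver
    triangleAt = relabel (_∸ N) triangle

    triangleAt-hasCycle : HasCycle triangleAt
    triangleAt-hasCycle = relabel-hasCycle (_∸ N) (N +_) triangle (m+n∸m≡n N) triangle-hasCycle

    window : List ℕ
    window = cycleVertices triangleAt triangleAt-hasCycle

    ∈window⇒bounded : ∀ {x} → x ∈ window → N ≤ x × x < N + 3
    ∈window⇒bounded x∈W with i , _ , refl ← ∈-applyUpTo⁻ (λ i → N + i % 3) x∈W =
      m≤m+n N _ , +-monoʳ-< N (m%n<n i 3)

  graftTriangle : Quiver → Quiver
  graftTriangle = overwrite window triangleAt

  graftTriangle-hasCycle : ∀ Q → HasCycle (graftTriangle Q)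
  graftTriangle-hasCycle Q =
    hasCycle-transport triangleAt (graftTriangle Q) triangleAt-hasCycle (overwrite-inside window triangleAt Q)

  graftTriangle-below : ∀ Q x y → x < N ⊎ y < N → arr (graftTriangle Q) x y ≡ arr Q x y
  graftTriangle-below Q _ _ = overwrite-outside window triangleAt Q ∘ Sum.map below below
    where
    below : ∀ {x} → x < N → x ∉ window
    below x<N x∈W = <⇒≱ x<N (proj₁ (∈window⇒bounded x∈W))

  graftTriangle-locallyFinite : ∀ {Q} → LocallyFinite Q → LocallyFinite (graftTriangle Q)
  graftTriangle-locallyFinite {Q} = locallyFinite-eventuallyEqual (N + 3) λ _ _ N+3≤y →
    overwrite-outside window triangleAt Q (inj₂ λ y∈W → <⇒≱ (proj₂ (∈window⇒bounded y∈W)) N+3≤y)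

∈⇒<suc-max : ∀ {x V} → x ∈ V → x < suc (max 0 V)
∈⇒<suc-max {V = V} x∈V = s≤s (All.lookup (xs≤max 0 V) x∈V)

hasCycle-meetsEveryNbhdAF : AFTopology.MeetsEveryNbhd HasCycle
hasCycle-meetsEveryNbhdAF Q V =
  graftTriangle N Q , (λ x y x∈V _ → graftTriangle-below N Q x y (inj₁ (∈⇒<suc-max x∈V))) ,
  graftTriangle-hasCycle N Q
  where N = suc (max 0 V)

hasCycle-meetsEveryNbhdLF : LFTopology.MeetsEveryNbhd (HasCycle ∘ proj₁)
hasCycle-meetsEveryNbhdLF (Q , finite) V =
  (graftTriangle N Q , graftTriangle-locallyFinite N finite) ,
  (λ x y → graftTriangle-below N Q x y ∘ Sum.map ∈⇒<suc-max ∈⇒<suc-max) ,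
  graftTriangle-hasCycle N Q
  where N = suc (max 0 V)

proposition4p19 : ExcludedMiddle 0ℓ →
    (¬ LF.Dense AcycLF × LF.EmptyInterior AcycLF × LF.IsClosed AcycLF)
    × (¬ AF.Dense AcycAF × AF.EmptyInterior AcycAF × AF.IsClosed AcycAF)
proposition4p19 em =
  ( LFTopology.open∧nonempty⇒∁-¬Dense hasCycle-openLF cyclicLF
  , LFTopology.meetsEveryNbhd⇒∁-EmptyInterior hasCycle-meetsEveryNbhdLF
  , LFTopology.open⇒∁-closed (em⇒dne em) hasCycle-openLF )
  , ( AFTopology.open∧nonempty⇒∁-¬Dense hasCycle-openAF (triangle , triangle-hasCycle)
  , AFTopology.meetsEveryNbhd⇒∁-EmptyInterior hasCycle-meetsEveryNbhdAF
  , AFTopology.open⇒∁-closed (em⇒dne em) hasCycle-openAF )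
  where
  cyclicLF : Σ LFQuiver (HasCycle ∘ proj₁)
  cyclicLF = (graftTriangle 0 emptyQuiver , graftTriangle-locallyFinite 0 emptyQuiver-locallyFinite)
           , graftTriangle-hasCycle 0 emptyQuiver
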